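{- Let $G$ be a connected $3$-regular graph with cutwidth $r+1$, and let $f,g:E(G)\to\{0,1\}$. Then $\varphi(G,f,g)$ cannot be refuted by width-$r$ resolution, i.e. it is not the case that $\emptyset\sim_r^-\emptyset$.
   Context: For a $3$-regular graph $G$ and $f,g:E(G)\to\{0,1\}$, $\varphi(G,f,g)$ is the following system of linear equations over $\mathbb{F}_2$. For every vertex $v$ with neighbors $u_1,u_2,u_3$ there are variables $x_{(v,u_i)},y_{(v,u_i)}$, $i=1,2,3$, and constraints $x_{(v,u_i)}\oplus y_{(v,u_i)}=0$ ($i=1,2,3$) and $y_{(v,u_1)}\oplus y_{(v,u_2)}\oplus y_{(v,u_3)}=0$; for every edge $\{u,v\}$ there is a constraint $x_{(u,v)}\oplus x_{(v,u)}=f(\{u,v\})\oplus g(\{u,v\})$. Resolution. A constraint $\phi$ is $\bigoplus_{z\in U}z=c$ for a set $U$ of variables and $c\in\{0,1\}$. For sets $S,T$ of variables, write $S\vdash_+T$ if some constraint $\phi$ of $\varphi(G,f,g)$ with right-hand side $0$ has variable set $U$ with $T=S\triangle U$, and $S\vdash_-T$ if the same holds for some constraint with right-hand side $1$. For $|S|,|T|\le w$, $S\sim_w^+T$ (resp. $S\sim_w^-T$) means there is a sequence $S=S_0,S_1,\dots,S_t=T$ of sets of variables with $|S_i|\le w$ for all $i$, each consecutive pair satisfying $S_i\vdash_+S_{i+1}$ or $S_i\vdash_-S_{i+1}$, and the number of $\vdash_-$ steps even (resp. odd). Cutwidth: $CW(G)=\min_\pi\max_i|E(\pi^{ -1}(\{1..i\}),V(G)\setminus\pi^{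 -1}(\{1..i\}))|$ over orderings $\pi:V(G)\to\{1,\dots,|V(G)|\}$. -}

module Defs where

open import Data.Nat using (ℕ; zero; suc; _+_; _≤_; _<_; _⊔_)
open import Data.Nat.Properties using (_<?_)
open import Data.Bool using (Bool; true; false; T; _xor_; _∧_; if_then_else_; not)
open import Data.Fin using (Fin; toℕ; _≟_)
open import Data.Fin.Permutation using (Permutation′; _⟨$⟩ʳ_)
open import Data.List using (List; map; foldr; allFin; upTo)
open import Data.Nat.ListAction using (sum)
open import Data.Product using (Σ; ∃; _×_; _,_)
open import Relation.Nullary.Decidable using (⌊_⌋)
open import Relation.Binary.PropositionalEquality using (_≡_)

record Graph (n : ℕ) : Set where
  field
    adj   : Fin n → Fin n → Bool
    sym   : ∀ u v → adj u v ≡ adj v u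
    irrefl : ∀ v → adj v v ≡ false
open Graph public

b2n : Bool → ℕ
b2n true  = 1
b2n false = 0

sumFin : ∀ {n} → (Fin n → ℕ) → ℕ
sumFin {n} h = sum (map h (allFin n))

count : ∀ {n} → (Fin n → Bool) → ℕ
count p = sumFin (λ i → b2n (p i))

degree : ∀ {n} → Graph n → Fin n → ℕ
degree G v = count (adj G v)

Cubic : ∀ {n} → Graph n → Set
Cubic G = ∀ v → degree G v ≡ 3

data Reach {n} (G : Graph n) : Fin n → Fin n → Set where
  here  : ∀ {u} → Reach G u u
  there : ∀ {u w v} → T (adj G u w) → Reach G w v → Reach G u v

Connected : ∀ {n} → Graph n → Set
Connected G = ∀ u v → Reach G u v

-- An ordering is a permutation π : Fin n ↔ Fin n (positions
-- 0..n-1).  cut π i = number of edges between the first i vertices and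
-- the rest: ordered adjacent pairs (a,b) with π a < i ≤ π b (each
-- crossing edge counted exactly once).

cut : ∀ {n} → Graph n → Permutation′ n → ℕ → ℕ
cut G π i =
  sumFin (λ a → count (λ b →
    adj G a b ∧ ⌊ toℕ (π ⟨$⟩ʳ a) <? i ⌋ ∧ not ⌊ toℕ (π ⟨$⟩ʳ b) <? i ⌋))

-- max over i ∈ {0,…,n} of cut π i  (i = 0 and i = n contribute 0)
orderWidth : ∀ {n} → Graph n → Permutation′ n → ℕ
orderWidth {n} G π = foldr _⊔_ 0 (map (cut G π) (upTo (suc n)))

HasCutwidth : ∀ {n} → Graph n → ℕ → Set
HasCutwidth G c = (∃ λ π → orderWidth G π ≡ c) × (∀ π → c ≤ orderWidth G π)

-- The system φ(G,f,g).  Variables x_(v,u), y_(v,u) are indexed by a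
-- kind, v and u (only those with u adjacent to v occur in constraints).
-- A set of variables is a characteristic function.

data Kind : Set where
  xk yk : Kind

kindEq : Kind → Kind → Bool
kindEq xk xk = true
kindEq yk yk = true
kindEq _  _  = false

VarSet : ℕ → Set
VarSet n = Kind → Fin n → Fin n → Bool

∅ : ∀ {n} → VarSet n
∅ _ _ _ = false

single : ∀ {n} → Kind → Fin n → Fin n → VarSet n
single k v u k' v' u' = kindEq k k' ∧ ⌊ v ≟ v' ⌋ ∧ ⌊ u ≟ u' ⌋

_∪₂_ : ∀ {n} → VarSet n → VarSet n → VarSet n
(S ∪₂ T) k v u = S k v u xor T k v u

size : ∀ {n} → VarSet n → ℕ
size S = sumFin (λ v → sumFin (λ u → b2n (S xk v u) + b2n (S yk v u)))

data Constraint {n} (G : Graph n) : Set where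
  -- x_(v,u) ⊕ y_(v,u) = 0   for u a neighbour of v
  xy   : (v u : Fin n) → T (adj G v u) → Constraint G
  -- ⊕_{u ∼ v} y_(v,u) = 0
  ysum : (v : Fin n) → Constraint G
  -- x_(u,v) ⊕ x_(v,u) = f{u,v} ⊕ g{u,v}   for an edge {u,v}
  edge : (u v : Fin n) → T (adj G u v) → Constraint G

vars : ∀ {n} {G : Graph n} → Constraint G → VarSet n
vars (xy v u _) = single xk v u ∪₂ single yk v u
vars {G = G} (ysum v) k v' u = kindEq yk k ∧ ⌊ v ≟ v' ⌋ ∧ adj G v u
vars (edge u v _) = single xk u v ∪₂ single xk v u

-- edge labellings f, g : E(G) → {0,1}, given as symmetric functions
EdgeFun : ℕ → Set
EdgeFun n = Fin n → Fin n → Bool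

rhs : ∀ {n} {G : Graph n} → EdgeFun n → EdgeFun n → Constraint G → Bool
rhs f g (xy _ _ _)   = false
rhs f g (ysum _)     = false
rhs f g (edge u v _) = f u v xor g u v

Step : ∀ {n} {G : Graph n} → Constraint G → VarSet n → VarSet n → Set
Step φ S T′ = ∀ k v u → T′ k v u ≡ (S ∪₂ vars φ) k v u

-- Deriv G f g w S T b : a sequence S = S₀,…,S_t = T with all |S_i| ≤ w,
-- consecutive sets related by ⊢₊/⊢₋, and b = parity of the number of ⊢₋ steps.
data Deriv {n} (G : Graph n) (f g : EdgeFun n) (w : ℕ)
     : VarSet n → VarSet n → Bool → Set where
  done : ∀ {S T′} → size S ≤ w → (∀ k v u → S k v u ≡ T′ k v u) →
         Deriv G f g w S T′ false
  step : ∀ {S S′ T′ b} (φ : Constraint G) → size S ≤ w → Step φ S S′ →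
         Deriv G f g w S′ T′ b → Deriv G f g w S T′ (rhs f g φ xor b)

_∼⁻[_,_,_,_]_ : ∀ {n} → VarSet n → (G : Graph n) → EdgeFun n → EdgeFun n → ℕ → VarSet n → Set
S ∼⁻[ G , f , g , w ] T′ = Deriv G f g w S T′ true

module Submission where

-- Suppose S₀ = ∅, S₁, …, S_t = ∅ is a derivation of width r with an odd
-- number of ⊢₋ steps.  Along it we track two sets: B, the vertices whose
-- parity constraint ⊕_u y_(v,u) = 0 has been used an odd number of times,
-- and C, the (symmetric) set of edges whose edge constraint has.  The
-- invariant [x_(v,u) ∈ S] ⊕ [y_(v,u) ∈ S] = C(v,u) ⊕ B(v) on every edge
-- (Accounts) forces every edge leaving B to contribute a variable to S, so
-- |∂B| ≤ |S| ≤ r.  B changes one vertex at a time, and via submodularity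
-- of cuts we maintain a frontier of B: a grown set (reached from ∅ one
-- vertex at a time through sets of boundary ≤ r) containing B with least
-- boundary above B.  At the end S = ∅, so B is ∅ or everything (G is
-- connected).  If B is everything, the frontier is a grown set of all
-- vertices, i.e. an ordering of width ≤ r, contradicting CW(G) = r + 1.
-- If B = ∅ then C vanishes on edges, and the parity of the derivation is
-- the sum of f ⊕ g over C, which is 0 — not odd.

open import Defs hiding (sym)
open import Algebra.Bundles using (CommutativeRing)
import Algebra.Properties.CommutativeMonoid.Sum as MonoidSum
import Algebra.Properties.Semiring.Sum as SemiringSum
open import Data.Bool using (Bool; true; false; not; _∧_; _∨_; _xor_; T; if_then_else_)
open import Data.Bool.Properties
  using (xor-∧-commutativeRing; T-∧; T-∨; xor-identityʳ; xor-assoc; xor-comm; not-involutive;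
         ∧-comm; ∧-assoc; ∧-zeroʳ; ∧-identityʳ; ∧-distribʳ-xor; ∧-distribˡ-xor;
         ∨-zeroʳ; ∨-identityʳ)
open import Algebra.Properties.CommutativeSemigroup
  (CommutativeRing.+-commutativeSemigroup xor-∧-commutativeRing)
  using (interchange; xy∙z≈xz∙y)
open import Data.Empty using (⊥-elim)
open import Data.Fin using (Fin; zero; suc; toℕ; _≟_; fromℕ; fromℕ<)
open import Data.Fin.Properties using (all?; any?; toℕ-injective; toℕ<n; toℕ-fromℕ; toℕ-fromℕ<)
open import Data.Fin.Permutation
  using (Permutation′; _⟨$⟩ʳ_; _⟨$⟩ˡ_; _∘ₚ_; transpose; inverseˡ; inverseʳ; id)
import Data.Fin.Permutation.Components as PC
open import Data.Fin.Subset.Properties using (anySubset?)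
open import Data.List using (map; tabulate)
open import Data.List.Properties using (foldr-preservesᵇ)
open import Data.List.Relation.Unary.All.Properties using (map⁺; applyUpTo⁺₁)
open import Data.Nat using (ℕ; zero; suc; _+_; _≤_; _<_; _⊔_; z≤n; s≤s)
open import Data.Nat.ListAction using (sum)
open import Data.Nat.Properties
  using (+-0-commutativeMonoid; +-mono-≤; +-monoʳ-≤; +-monoˡ-≤; +-cancelˡ-≤; +-cancelʳ-≤;
         +-identityʳ; m≤m+n; m≤n+m; ≤-refl; ≤-trans; ≤-pred; ≤-antisym; ≤-reflexive; ≤⇒≯;
         ≤∧≢⇒<; ≤-<-trans; <-≤-trans; m<n⇒m<1+n; m≤n⇒m<n∨m≡n; ≮⇒≥; ⊔-lub; <-cmp; ≤ᵇ⇒≤; _<?_;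
         module ≤-Reasoning)
open import Data.Product using (Σ-syntax; _×_; _,_; proj₁; proj₂)
open import Data.Sum using (_⊎_; inj₁; inj₂; [_,_]′)
open import Data.Vec using (lookup) renaming (tabulate to tabulateᵛ)
open import Data.Vec.Properties using (lookup∘tabulate)
open import Function using (_∘_; _⇔_; Equivalence; mk⇔; case_of_)
open import Relation.Binary.Definitions using (tri<; tri≈; tri>)
open import Relation.Binary.PropositionalEquality
  using (_≡_; _≢_; refl; sym; trans; cong; cong₂; subst; module ≡-Reasoning)
open import Relation.Nullary using (¬_; Dec; yes; no)
open import Relation.Nullary.Decidable
  using (⌊_⌋; isYes≗does; dec-true; dec-false; does-⇔; ⌊⌋-map′; T?; _×-dec_; _→-dec_;
         toWitness; fromWitness)

⌊⌋-yes : ∀ {P : Set} (d : Dec P) → P → ⌊ d ⌋ ≡ true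
⌊⌋-yes d p = trans (isYes≗does d) (dec-true d p)

⌊⌋-no : ∀ {P : Set} (d : Dec P) → ¬ P → ⌊ d ⌋ ≡ false
⌊⌋-no d ¬p = trans (isYes≗does d) (dec-false d ¬p)

⌊⌋-⇔ : ∀ {P Q : Set} → P ⇔ Q → (d : Dec P) (e : Dec Q) → ⌊ d ⌋ ≡ ⌊ e ⌋
⌊⌋-⇔ P⇔Q d e = trans (isYes≗does d) (trans (does-⇔ P⇔Q d e) (sym (isYes≗does e)))

T⇒true : ∀ {b} → T b → b ≡ true
T⇒true {true} _ = refl

true⇒T : ∀ {b} → b ≡ true → T b
true⇒T refl = _

T-xor : ∀ {x y} → T (x xor y) → T x ⊎ T y
T-xor {true}  _ = inj₁ _
T-xor {false} t = inj₂ t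

xor-cancel : ∀ h p → h xor (p xor h) ≡ p
xor-cancel true  p = trans (cong not (xor-comm p true)) (not-involutive p)
xor-cancel false p = xor-identityʳ p

¬T⇒false : ∀ {b} → ¬ T b → b ≡ false
¬T⇒false {true}  ¬b = ⊥-elim (¬b _)
¬T⇒false {false} _  = refl

module ℕΣ = MonoidSum +-0-commutativeMonoid
module ⊕Σ = SemiringSum (CommutativeRing.semiring xor-∧-commutativeRing)

∑ : ∀ {m} → (Fin m → ℕ) → ℕ
∑ = ℕΣ.sum

∑-mono : ∀ {m} {h h′ : Fin m → ℕ} → (∀ i → h i ≤ h′ i) → ∑ h ≤ ∑ h′
∑-mono {zero}  _  = z≤n
∑-mono {suc m} le = +-mono-≤ (le zero) (∑-mono (le ∘ suc))

∑²-+ : ∀ {m} (F H : Fin m → Fin m → ℕ) →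
  ∑ (λ a → ∑ (λ b → F a b + H a b)) ≡ ∑ (λ a → ∑ (F a)) + ∑ (λ a → ∑ (H a))
∑²-+ F H = trans (ℕΣ.sum-cong-≗ (λ a → ℕΣ.∑-distrib-+ (F a) (H a)))
                 (ℕΣ.∑-distrib-+ (λ a → ∑ (F a)) (λ a → ∑ (H a)))

sum-map-tabulate : ∀ {m} {A : Set} (h : A → ℕ) (g : Fin m → A) →
  sum (map h (tabulate g)) ≡ ∑ (h ∘ g)
sum-map-tabulate {zero}  h g = refl
sum-map-tabulate {suc m} h g = cong (h (g zero) +_) (sum-map-tabulate h (g ∘ suc))

sumFin² : ∀ {m} (H : Fin m → Fin m → ℕ) →
  sumFin (λ a → sumFin (H a)) ≡ ∑ (λ a → ∑ (H a))
sumFin² H = trans (sum-map-tabulate (λ a → sumFin (H a)) (λ a → a))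
                  (ℕΣ.sum-cong-≗ (λ a → sum-map-tabulate (H a) (λ b → b)))

⊕-delta : ∀ {m} (u : Fin m) (p : Fin m → Bool) → ⊕Σ.sum (λ x → ⌊ u ≟ x ⌋ ∧ p x) ≡ p u
⊕-delta {suc m} zero p =
  trans (cong (p zero xor_) (⊕Σ.sum-replicate-zero m)) (xor-identityʳ (p zero))
⊕-delta (suc u) p =
  trans (⊕Σ.sum-cong-≗ (λ x → cong (_∧ p (suc x)) (⌊⌋-map′ (cong suc) _ (u ≟ x))))
        (⊕-delta u (p ∘ suc))

VSet : ℕ → Set
VSet n = Fin n → Bool

module _ {n : ℕ} where

  ∅ᵛ : VSet n
  ∅ᵛ _ = false

  ⁅_⁆ : Fin n → VSet n
  ⁅ v ⁆ x = ⌊ v ≟ x ⌋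

  _∩_ _∪_ _∖_ : VSet n → VSet n → VSet n
  (X ∩ Y) x = X x ∧ Y x
  (X ∪ Y) x = X x ∨ Y x
  (X ∖ Y) x = X x ∧ not (Y x)

  toggle : VSet n → Fin n → VSet n
  toggle X v x = X x xor ⌊ v ≟ x ⌋

  _⊆_ _≐_ : VSet n → VSet n → Set
  X ⊆ Y = ∀ x → T (X x) → T (Y x)
  X ≐ Y = ∀ x → X x ≡ Y x

  AtMostOne : VSet n → Set
  AtMostOne Z = ∀ u v → T (Z u) → T (Z v) → u ≡ v

  ⊆-refl : ∀ {X} → X ⊆ X
  ⊆-refl _ x∈ = x∈

  ⊆-trans : ∀ {X Y Z} → X ⊆ Y → Y ⊆ Z → X ⊆ Z
  ⊆-trans X⊆Y Y⊆Z x = Y⊆Z x ∘ X⊆Y x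

  ≐⇒⊆ : ∀ {X Y} → X ≐ Y → X ⊆ Y
  ≐⇒⊆ X≐Y x = subst T (X≐Y x)

  ⊆-antisym : ∀ {X Y} → X ⊆ Y → Y ⊆ X → X ≐ Y
  ⊆-antisym X⊆Y Y⊆X x = T-ext (X⊆Y x) (Y⊆X x)
    where
    T-ext : ∀ {a b} → (T a → T b) → (T b → T a) → a ≡ b
    T-ext {false} {false} _ _ = refl
    T-ext {false} {true}  _ b→a = ⊥-elim (b→a _)
    T-ext {true}  {false} a→b _ = ⊥-elim (a→b _)
    T-ext {true}  {true}  _ _ = refl

  ∩-⊆ʳ : ∀ {X Y} → (X ∩ Y) ⊆ Y
  ∩-⊆ʳ {X} {Y} x = proj₂ ∘ Equivalence.to (T-∧ {X x} {Y x})

  ∩-⊆ˡ : ∀ {X Y} → (X ∩ Y) ⊆ X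
  ∩-⊆ˡ {X} {Y} x = proj₁ ∘ Equivalence.to (T-∧ {X x} {Y x})

  ⊆-∩ : ∀ {X Y Z} → Z ⊆ X → Z ⊆ Y → Z ⊆ (X ∩ Y)
  ⊆-∩ {X} {Y} Z⊆X Z⊆Y x x∈ = Equivalence.from (T-∧ {X x} {Y x}) (Z⊆X x x∈ , Z⊆Y x x∈)

  ⊆-∪ˡ : ∀ {X Y} → X ⊆ (X ∪ Y)
  ⊆-∪ˡ {X} {Y} x = Equivalence.from (T-∨ {X x} {Y x}) ∘ inj₁

  ⊆-∪ʳ : ∀ {X Y} → Y ⊆ (X ∪ Y)
  ⊆-∪ʳ {X} {Y} x = Equivalence.from (T-∨ {X x} {Y x}) ∘ inj₂

  ∪-⊆ : ∀ {X Y Z} → X ⊆ Z → Y ⊆ Z → (X ∪ Y) ⊆ Z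
  ∪-⊆ {X} {Y} X⊆Z Y⊆Z x = [ X⊆Z x , Y⊆Z x ]′ ∘ Equivalence.to (T-∨ {X x} {Y x})

  ∖-intro : ∀ {X Y} x → T (Y x) → ¬ T (X x) → T ((Y ∖ X) x)
  ∖-intro {X} {Y} x y∈ x∉ with Y x | X x
  ... | true  | false = _
  ... | true  | true  = ⊥-elim (x∉ _)
  ... | false | _     = ⊥-elim y∈

  ∖-elim : ∀ {X Y} x → T ((Y ∖ X) x) → T (Y x) × ¬ T (X x)
  ∖-elim {X} {Y} x in∖ with Y x | X x
  ... | true  | false = _ , λ ()
  ... | true  | true  = ⊥-elim in∖
  ... | false | _     = ⊥-elim in∖

  AtMostOne-mono : ∀ {Z W} → Z ⊆ W → AtMostOne W → AtMostOne Z
  AtMostOne-mono Z⊆W one u v u∈ v∈ = one u v (Z⊆W u u∈) (Z⊆W v v∈)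

  ⁅⁆-self : ∀ v → T (⁅ v ⁆ v)
  ⁅⁆-self v = fromWitness refl

  ⁅⁆-elim : ∀ {v} x → T (⁅ v ⁆ x) → v ≡ x
  ⁅⁆-elim {v} x = toWitness

  ∖-empty : ∀ {X Y} → (∀ x → ¬ T ((Y ∖ X) x)) → Y ⊆ X
  ∖-empty {X} {Y} nothing-new x y∈ with T? (X x)
  ... | yes x∈ = x∈
  ... | no  x∉ = ⊥-elim (nothing-new x (∖-intro {X} {Y} x y∈ x∉))

  ∖-single : ∀ {X Y w} → AtMostOne (Y ∖ X) → T ((Y ∖ X) w) → Y ⊆ (X ∪ ⁅ w ⁆)
  ∖-single {X} {Y} {w} one w-new x y∈ with T? (X x)
  ... | yes x∈ = ⊆-∪ˡ {X = X} {Y = ⁅ w ⁆} x x∈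
  ... | no  x∉ = ⊆-∪ʳ {X = X} {Y = ⁅ w ⁆} x
    (subst (T ∘ ⁅ w ⁆) (one w x w-new (∖-intro {X} {Y} x y∈ x∉)) (⁅⁆-self w))


  toggle-⊆ : ∀ {X v} → T (X v) → toggle X v ⊆ X
  toggle-⊆ {X} {v} v∈X x with v ≟ x
  ... | yes refl = λ _ → v∈X
  ... | no  _    = subst T (xor-identityʳ (X x))

  ⊆-toggle : ∀ {X v} → ¬ T (X v) → X ⊆ toggle X v
  ⊆-toggle {X} {v} v∉X x with v ≟ x
  ... | yes refl = ⊥-elim ∘ v∉X
  ... | no  _    = subst T (sym (xor-identityʳ (X x)))

  toggle-new : ∀ {X v} → AtMostOne (toggle X v ∖ X)
  toggle-new {X} {v} u w u∈ w∈ = trans (sym (new-is-v u u∈)) (new-is-v w w∈)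
    where
    new-is-v : ∀ x → T ((toggle X v ∖ X) x) → v ≡ x
    new-is-v x in∖ with v ≟ x | ∖-elim {X} {toggle X v} x in∖
    ... | yes v≡x | _           = v≡x
    ... | no  _   | x∈ , x∉     = ⊥-elim (x∉ (subst T (xor-identityʳ (X x)) x∈))

-- A pair (a,b) leaves X ∩ Y and X ∪ Y at most as often in total as it
-- leaves X and Y; this is the pointwise form of submodularity of cuts.
leaves-submodular : ∀ t xa xb ya yb →
  b2n (t ∧ (xa ∧ ya) ∧ not (xb ∧ yb)) + b2n (t ∧ (xa ∨ ya) ∧ not (xb ∨ yb))
    ≤ b2n (t ∧ xa ∧ not xb) + b2n (t ∧ ya ∧ not yb)
leaves-submodular false _     _     _     _     = z≤n
leaves-submodular true  true  true  true  true  = ≤ᵇ⇒≤ _ _ _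
leaves-submodular true  true  true  true  false = ≤ᵇ⇒≤ _ _ _
leaves-submodular true  true  true  false true  = ≤ᵇ⇒≤ _ _ _
leaves-submodular true  true  true  false false = ≤ᵇ⇒≤ _ _ _
leaves-submodular true  true  false true  true  = ≤ᵇ⇒≤ _ _ _
leaves-submodular true  true  false true  false = ≤ᵇ⇒≤ _ _ _
leaves-submodular true  true  false false true  = ≤ᵇ⇒≤ _ _ _
leaves-submodular true  true  false false false = ≤ᵇ⇒≤ _ _ _
leaves-submodular true  false true  true  true  = ≤ᵇ⇒≤ _ _ _
leaves-submodular true  false true  true  false = ≤ᵇ⇒≤ _ _ _
leaves-submodular true  false true  false true  = ≤ᵇ⇒≤ _ _ _
leaves-submodular true  false true  false false = ≤ᵇ⇒≤ _ _ _
leaves-submodular true  false false true  true  = ≤ᵇ⇒≤ _ _ _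
leaves-submodular true  false false true  false = ≤ᵇ⇒≤ _ _ _
leaves-submodular true  false false false true  = ≤ᵇ⇒≤ _ _ _
leaves-submodular true  false false false false = ≤ᵇ⇒≤ _ _ _

cancel-≤ : ∀ {A B C D} → A + B ≤ C + D → C ≤ A → B ≤ D
cancel-≤ {A} {B} {C} {D} le C≤A = +-cancelˡ-≤ A B D (≤-trans le (+-monoˡ-≤ D C≤A))

module Boundary {n : ℕ} (G : Graph n) where

  leaves : VSet n → Fin n → Fin n → Bool
  leaves Y a b = adj G a b ∧ Y a ∧ not (Y b)

  boundary : VSet n → ℕ
  boundary Y = ∑ (λ a → ∑ (λ b → b2n (leaves Y a b)))

  boundary-cong : ∀ {X Y} → X ≐ Y → boundary X ≡ boundary Y
  boundary-cong X≐Y = ℕΣ.sum-cong-≗ λ a → ℕΣ.sum-cong-≗ λ b →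
    cong₂ (λ ya yb → b2n (adj G a b ∧ ya ∧ not yb)) (X≐Y a) (X≐Y b)

  boundary-∅ : boundary ∅ᵛ ≡ 0
  boundary-∅ = trans (ℕΣ.sum-cong-≗ λ a → trans
      (ℕΣ.sum-cong-≗ λ b → cong b2n (∧-zeroʳ (adj G a b)))
      (ℕΣ.sum-replicate-zero n))
    (ℕΣ.sum-replicate-zero n)

  boundary-submodular : ∀ X Y →
    boundary (X ∩ Y) + boundary (X ∪ Y) ≤ boundary X + boundary Y
  boundary-submodular X Y = begin
    boundary (X ∩ Y) + boundary (X ∪ Y)
      ≡⟨ ∑²-+ (λ a b → b2n (leaves (X ∩ Y) a b)) (λ a b → b2n (leaves (X ∪ Y) a b)) ⟨
    ∑ (λ a → ∑ (λ b → b2n (leaves (X ∩ Y) a b) + b2n (leaves (X ∪ Y) a b)))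
      ≤⟨ ∑-mono (λ a → ∑-mono (λ b → leaves-submodular (adj G a b) (X a) (X b) (Y a) (Y b))) ⟩
    ∑ (λ a → ∑ (λ b → b2n (leaves X a b) + b2n (leaves Y a b)))
      ≡⟨ ∑²-+ (λ a b → b2n (leaves X a b)) (λ a b → b2n (leaves Y a b)) ⟩
    boundary X + boundary Y ∎
    where open ≤-Reasoning

  boundary-uncross : ∀ {Y Z} → boundary Y ≤ boundary (Y ∩ Z) → boundary (Y ∪ Z) ≤ boundary Z
  boundary-uncross {Y} {Z} = cancel-≤ (boundary-submodular Y Z)

_⊆?_ : ∀ {n} (X Y : VSet n) → Dec (X ⊆ Y)
X ⊆? Y = all? (λ x → T? (X x) →-dec T? (Y x))

module _ {n : ℕ} (h : VSet n → ℕ) (h-cong : ∀ {X Y} → X ≐ Y → h X ≡ h Y) where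

  MinimumBetween : VSet n → VSet n → VSet n → Set
  MinimumBetween L U Y = L ⊆ Y × Y ⊆ U × (∀ Z → L ⊆ Z → Z ⊆ U → h Y ≤ h Z)

  minimum-between : ∀ {L U} → L ⊆ U → Σ[ Y ∈ VSet n ] MinimumBetween L U Y
  minimum-between {L} {U} L⊆U = descend (suc (h L)) L ≤-refl ⊆-refl L⊆U
    where
    descend : ∀ fuel Y → h Y < fuel → L ⊆ Y → Y ⊆ U → Σ[ Y ∈ VSet n ] MinimumBetween L U Y
    descend zero _ () _ _
    descend (suc fuel) Y hY<fuel L⊆Y Y⊆U
      with anySubset? (λ s → (L ⊆? lookup s) ×-dec (lookup s ⊆? U) ×-dec (h (lookup s) <? h Y))
    ... | yes (s , L⊆s , s⊆U , smaller) =
      descend fuel (lookup s) (<-≤-trans smaller (≤-pred hY<fuel)) L⊆s s⊆U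
    ... | no no-smaller = Y , L⊆Y , Y⊆U , λ Z L⊆Z Z⊆U → ≮⇒≥ λ Z<Y → no-smaller
      ( tabulateᵛ Z
      , ⊆-trans L⊆Z (≐⇒⊆ (sym ∘ lookup∘tabulate Z))
      , ⊆-trans (≐⇒⊆ (lookup∘tabulate Z)) Z⊆U
      , subst (_< h Y) (sym (h-cong (lookup∘tabulate Z))) Z<Y )

prefix : ∀ {n} → Permutation′ n → ℕ → VSet n
prefix π i a = ⌊ toℕ (π ⟨$⟩ʳ a) <? i ⌋

cut≡boundary : ∀ {n} (G : Graph n) π i → cut G π i ≡ Boundary.boundary G (prefix π i)
cut≡boundary G π i = sumFin² (λ a b → b2n (Boundary.leaves G (prefix π i) a b))

orderWidth-≤ : ∀ {n} (G : Graph n) π {k} → (∀ j → j ≤ n → cut G π j ≤ k) → orderWidth G π ≤ k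
orderWidth-≤ {n} G π {k} bound =
  foldr-preservesᵇ {P = _≤ k} {f = _⊔_} ⊔-lub z≤n
    (map⁺ (applyUpTo⁺₁ (λ j → j) (suc n) (bound _ ∘ ≤-pred)))

prefix-covers : ∀ {n} (π : Permutation′ n) i → (∀ a → T (prefix π i a)) → n ≤ i
prefix-covers {zero}  _ _ _   = z≤n
prefix-covers {suc m} π i all =
  subst (_< i) (trans (cong toℕ (inverseʳ π)) (toℕ-fromℕ m)) (toWitness (all (π ⟨$⟩ˡ fromℕ m)))

not-below : ∀ {n j} (x : Fin n) → j ≤ toℕ x → ⌊ toℕ x <? j ⌋ ≡ false
not-below {j = j} x j≤x = ⌊⌋-no (toℕ x <? j) (≤⇒≯ j≤x)

transpose-cases : ∀ {n} (q p x : Fin n) →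
  (x ≡ q × PC.transpose q p x ≡ p) ⊎ (x ≡ p × PC.transpose q p x ≡ q) ⊎
  (x ≢ q × x ≢ p × PC.transpose q p x ≡ x)
transpose-cases q p x with x ≟ q
... | yes x≡q = inj₁ (x≡q , refl)
... | no  x≢q with x ≟ p
...   | yes x≡p = inj₂ (inj₁ (x≡p , refl))
...   | no  x≢p = inj₂ (inj₂ (x≢q , x≢p , refl))

module _ {n : ℕ} (q p : Fin n) (q≤p : toℕ q ≤ toℕ p) where

  transpose-below : ∀ j → j ≤ toℕ q → ∀ x →
    ⌊ toℕ (PC.transpose q p x) <? j ⌋ ≡ ⌊ toℕ x <? j ⌋
  transpose-below j j≤q x with transpose-cases q p x
  ... | inj₁ (refl , τx≡p) =
    trans (cong (λ y → ⌊ toℕ y <? j ⌋) τx≡p)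
          (trans (not-below p (≤-trans j≤q q≤p)) (sym (not-below x j≤q)))
  ... | inj₂ (inj₁ (refl , τx≡q)) =
    trans (cong (λ y → ⌊ toℕ y <? j ⌋) τx≡q)
          (trans (not-below q j≤q) (sym (not-below x (≤-trans j≤q q≤p))))
  ... | inj₂ (inj₂ (_ , _ , τx≡x)) = cong (λ y → ⌊ toℕ y <? j ⌋) τx≡x

  transpose-extends : ∀ x →
    ⌊ toℕ (PC.transpose q p x) <? suc (toℕ q) ⌋ ≡ ⌊ toℕ x <? toℕ q ⌋ ∨ ⌊ p ≟ x ⌋
  transpose-extends x with transpose-cases q p x
  ... | inj₁ (refl , τx≡p) =
    trans (cong (λ y → ⌊ toℕ y <? suc (toℕ q) ⌋) τx≡p)
      (trans (⌊⌋-⇔ (mk⇔ (λ p<q+1 → toℕ-injective (≤-antisym (≤-pred p<q+1) q≤p))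
                          (λ p≡q → s≤s (≤-reflexive (cong toℕ p≡q))))
                     (toℕ p <? suc (toℕ q)) (p ≟ x))
             (cong (_∨ ⌊ p ≟ x ⌋) (sym (not-below x ≤-refl))))
  ... | inj₂ (inj₁ (refl , τx≡q)) =
    trans (cong (λ y → ⌊ toℕ y <? suc (toℕ q) ⌋) τx≡q)
      (trans (⌊⌋-yes (toℕ q <? suc (toℕ q)) ≤-refl)
             (sym (trans (cong (⌊ toℕ x <? toℕ q ⌋ ∨_) (⌊⌋-yes (x ≟ x) refl)) (∨-zeroʳ _))))
  ... | inj₂ (inj₂ (x≢q , x≢p , τx≡x)) =
    trans (cong (λ y → ⌊ toℕ y <? suc (toℕ q) ⌋) τx≡x)
      (trans (⌊⌋-⇔ (mk⇔ (λ x<q+1 → ≤∧≢⇒< (≤-pred x<q+1) (x≢q ∘ toℕ-injective)) m<n⇒m<1+n)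
                     (toℕ x <? suc (toℕ q)) (toℕ x <? toℕ q))
             (sym (trans (cong (⌊ toℕ x <? toℕ q ⌋ ∨_) (⌊⌋-no (p ≟ x) (x≢p ∘ sym)))
                         (∨-identityʳ _))))

Moved : ∀ {n} → Permutation′ n → ℕ → Fin n → Set
Moved {n} π i w = Σ[ π′ ∈ Permutation′ n ]
  (prefix π′ (suc i) ≐ (prefix π i ∪ ⁅ w ⁆)) × (∀ j → j ≤ i → prefix π′ j ≐ prefix π j)

move-to : ∀ {n} (π : Permutation′ n) (q : Fin n) w → toℕ q ≤ toℕ (π ⟨$⟩ʳ w) → Moved π (toℕ q) w
move-to π q w q≤p = π ∘ₚ transpose q p , extends , keeps
  where
  p = π ⟨$⟩ʳ w
  π-injective : ∀ {a b} → π ⟨$⟩ʳ a ≡ π ⟨$⟩ʳ b → a ≡ b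
  π-injective {a} {b} e = trans (sym (inverseˡ π)) (trans (cong (π ⟨$⟩ˡ_) e) (inverseˡ π))
  extends : prefix (π ∘ₚ transpose q p) (suc (toℕ q)) ≐ (prefix π (toℕ q) ∪ ⁅ w ⁆)
  extends a = trans (transpose-extends q p q≤p (π ⟨$⟩ʳ a))
    (cong (prefix π (toℕ q) a ∨_) (⌊⌋-⇔ (mk⇔ π-injective (cong (π ⟨$⟩ʳ_))) (p ≟ _) (w ≟ a)))
  keeps : ∀ j → j ≤ toℕ q → prefix (π ∘ₚ transpose q p) j ≐ prefix π j
  keeps j j≤q a = transpose-below q p q≤p j j≤q (π ⟨$⟩ʳ a)

move-to-position : ∀ {n} (π : Permutation′ n) i w → i ≤ toℕ (π ⟨$⟩ʳ w) → Moved π i w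
move-to-position π i w i≤p
  with fromℕ< (≤-<-trans i≤p (toℕ<n _)) | toℕ-fromℕ< (≤-<-trans i≤p (toℕ<n _))
... | q | refl = move-to π q w i≤p

module Growth {n : ℕ} (G : Graph n) (k : ℕ) where
  open Boundary G

  data Grown : VSet n → Set where
    start : Grown ∅ᵛ
    grow  : ∀ {X Y} → Grown X → X ⊆ Y → AtMostOne (Y ∖ X) → boundary Y ≤ k → Grown Y

  Grown-boundary : ∀ {Y} → Grown Y → boundary Y ≤ k
  Grown-boundary start          = subst (_≤ k) (sym boundary-∅) z≤n
  Grown-boundary (grow _ _ _ b) = b

  Grown-resp : ∀ {X Y} → X ≐ Y → Grown X → Grown Y
  Grown-resp {X} {Y} X≐Y g =
    grow g (≐⇒⊆ X≐Y) nothing-new (subst (_≤ k) (boundary-cong X≐Y) (Grown-boundary g))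
    where
    nothing-new : AtMostOne (Y ∖ X)
    nothing-new u _ u∈ _ =
      let y∈ , x∉ = ∖-elim {X = X} {Y = Y} u u∈ in ⊥-elim (x∉ (≐⇒⊆ (sym ∘ X≐Y) u y∈))

  Grown-∩ : ∀ {A B} → Grown A → (∀ C → C ⊆ A → boundary B ≤ boundary (C ∪ B)) →
    Grown (A ∩ B)
  Grown-∩ start _ = start
  Grown-∩ {A} {B} (grow {X = X} g X⊆A one bA) B-least =
    grow (Grown-∩ g (λ C C⊆X → B-least C (⊆-trans C⊆X X⊆A)))
         (⊆-∩ (⊆-trans ∩-⊆ˡ X⊆A) ∩-⊆ʳ)
         (AtMostOne-mono new one)
         (≤-trans bound bA)
    where
    new : ((A ∩ B) ∖ (X ∩ B)) ⊆ (A ∖ X)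
    new x in∖ =
      let a∧b , x∧b∉ = ∖-elim {X = X ∩ B} {Y = A ∩ B} x in∖
          x∈B = ∩-⊆ʳ {X = A} {Y = B} x a∧b
      in ∖-intro {X = X} {Y = A} x (∩-⊆ˡ {X = A} {Y = B} x a∧b)
           (λ x∈X → x∧b∉ (Equivalence.from T-∧ (x∈X , x∈B)))
    bound : boundary (A ∩ B) ≤ boundary A
    bound = +-cancelʳ-≤ (boundary (A ∪ B)) (boundary (A ∩ B)) (boundary A)
      (≤-trans (boundary-submodular A B) (+-monoʳ-≤ (boundary A) (B-least A ⊆-refl)))

  record Frontier (X : VSet n) : Set where
    constructor frontier
    field
      hull    : VSet n
      grown   : Grown hull
      covers  : X ⊆ hull
      minimal : ∀ Z → X ⊆ Z → Z ⊆ hull → boundary hull ≤ boundary Z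

  frontier-∅ : Frontier ∅ᵛ
  frontier-∅ = frontier ∅ᵛ start ⊆-refl (λ Z _ _ → subst (_≤ boundary Z) (sym boundary-∅) z≤n)

  -- Shrinking X: replace the hull by a least-boundary set between X′ and it.
  frontier-shrink : ∀ {X X′} → X′ ⊆ X → Frontier X → Frontier X′
  frontier-shrink {X} {X′} X′⊆X (frontier Y grown X⊆Y _)
    with minimum-between boundary boundary-cong (⊆-trans X′⊆X X⊆Y)
  ... | Y* , X′⊆Y* , Y*⊆Y , least =
    frontier Y* (Grown-resp Y∩Y*≐Y* (Grown-∩ grown Y*-least)) X′⊆Y*
      (λ Z X′⊆Z Z⊆Y* → least Z X′⊆Z (⊆-trans Z⊆Y* Y*⊆Y))
    where
    Y∩Y*≐Y* : (Y ∩ Y*) ≐ Y*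
    Y∩Y*≐Y* = ⊆-antisym ∩-⊆ʳ (⊆-∩ Y*⊆Y ⊆-refl)
    Y*-least : ∀ C → C ⊆ Y → boundary Y* ≤ boundary (C ∪ Y*)
    Y*-least C C⊆Y = least (C ∪ Y*) (⊆-trans X′⊆Y* ⊆-∪ʳ) (∪-⊆ C⊆Y Y*⊆Y)

  -- Growing X by at most one vertex: add the new vertex to the hull.  The
  -- hull stays minimal by uncrossing against its minimality for X.
  frontier-grow : ∀ {X X′} → X ⊆ X′ → AtMostOne (X′ ∖ X) → boundary X′ ≤ k →
    Frontier X → Frontier X′
  frontier-grow {X} {X′} X⊆X′ one bX′ (frontier Y grown X⊆Y minimal) =
    frontier (Y ∪ X′) (grow grown ⊆-∪ˡ (AtMostOne-mono new one) (≤-trans (uncross X′ X⊆X′) bX′))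
      ⊆-∪ʳ least
    where
    new : ((Y ∪ X′) ∖ Y) ⊆ (X′ ∖ X)
    new x in∖ =
      let in∪ , y∉ = ∖-elim {X = Y} {Y = Y ∪ X′} x in∖
      in ∖-intro {X = X} {Y = X′} x
           ([ ⊥-elim ∘ y∉ , (λ x∈ → x∈) ]′ (Equivalence.to (T-∨ {Y x} {X′ x}) in∪))
           (y∉ ∘ X⊆Y x)
    uncross : ∀ Z → X ⊆ Z → boundary (Y ∪ Z) ≤ boundary Z
    uncross Z X⊆Z = boundary-uncross {Y} {Z} (minimal (Y ∩ Z) (⊆-∩ X⊆Y X⊆Z) ∩-⊆ˡ)
    least : ∀ Z → X′ ⊆ Z → Z ⊆ (Y ∪ X′) → boundary (Y ∪ X′) ≤ boundary Z
    least Z X′⊆Z Z⊆Y∪X′ =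
      subst (_≤ boundary Z)
        (boundary-cong (⊆-antisym (∪-⊆ ⊆-∪ˡ Z⊆Y∪X′) (∪-⊆ ⊆-∪ˡ (⊆-trans X′⊆Z ⊆-∪ʳ))))
        (uncross Z (⊆-trans X⊆X′ X′⊆Z))

  frontier-toggle : ∀ {X} v → boundary (toggle X v) ≤ k → Frontier X → Frontier (toggle X v)
  frontier-toggle {X} v b F with T? (X v)
  ... | yes v∈X = frontier-shrink (toggle-⊆ v∈X) F
  ... | no  v∉X = frontier-grow (⊆-toggle v∉X) (toggle-new {X = X} {v = v}) b F

  record Layout (Y : VSet n) : Set where
    constructor layout
    field
      order  : Permutation′ n
      length : ℕ
      placed : Y ≐ prefix order length
      narrow : ∀ j → j ≤ length → boundary (prefix order j) ≤ k

  -- A growth step X ⊆ Y places the (at most one) new vertex right after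
  -- the prefix representing X.
  layout-step : ∀ {X Y} → Layout X → X ⊆ Y → AtMostOne (Y ∖ X) → boundary Y ≤ k → Layout Y
  layout-step {X} {Y} (layout π i X≐ narrow) X⊆Y one bY with any? (λ w → T? ((Y ∖ X) w))
  ... | no nothing-new =
    layout π i (λ a → trans (⊆-antisym (∖-empty (λ x new → nothing-new (x , new))) X⊆Y a) (X≐ a))
      narrow
  ... | yes (w , w-new) with ∖-elim {X = X} {Y = Y} w w-new
  ...   | w∈Y , w∉X with move-to-position π i w (≮⇒≥ (w∉X ∘ subst T (sym (X≐ w)) ∘ fromWitness))
  ...     | π′ , extends , keeps = layout π′ (suc i) placed′ narrow′
    where
    Y≐X∪w : Y ≐ (X ∪ ⁅ w ⁆)
    Y≐X∪w = ⊆-antisym (∖-single one w-new)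
                      (∪-⊆ X⊆Y (λ x w≡x → subst (T ∘ Y) (⁅⁆-elim x w≡x) w∈Y))
    placed′ : Y ≐ prefix π′ (suc i)
    placed′ a = trans (Y≐X∪w a) (trans (cong (_∨ ⁅ w ⁆ a) (X≐ a)) (sym (extends a)))
    narrow′ : ∀ j → j ≤ suc i → boundary (prefix π′ j) ≤ k
    narrow′ j j≤i+1 with m≤n⇒m<n∨m≡n j≤i+1
    ... | inj₁ j<i+1 =
      subst (_≤ k) (sym (boundary-cong (keeps j (≤-pred j<i+1)))) (narrow j (≤-pred j<i+1))
    ... | inj₂ refl = subst (_≤ k) (boundary-cong placed′) bY

  grown⇒layout : ∀ {Y} → Grown Y → Layout Y
  grown⇒layout start               = layout id 0 (λ _ → refl) λ { .0 z≤n → Grown-boundary start }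
  grown⇒layout (grow g X⊆Y one bY) = layout-step (grown⇒layout g) X⊆Y one bY

  grown-everything : ∀ {Y} → Grown Y → (∀ a → T (Y a)) → Σ[ π ∈ Permutation′ n ] orderWidth G π ≤ k
  grown-everything g everything with grown⇒layout g
  ... | layout π i placed narrow = π , orderWidth-≤ G π λ j j≤n →
    subst (_≤ k) (sym (cut≡boundary G π j))
      (narrow j (≤-trans j≤n (prefix-covers π i (λ a → subst T (placed a) (everything a)))))

connected-constant : ∀ {n} {G : Graph n} → Connected G → (B : VSet n) →
  (∀ v u → T (adj G v u) → B v ≡ B u) → ∀ u v → B u ≡ B v
connected-constant {G = G} connected B agree u v = along (connected u v)
  where
  along : ∀ {u v} → Reach G u v → B u ≡ B v
  along here          = refl
  along (there uw wv) = trans (agree _ _ uw) (along wv)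

module Accounting {n : ℕ} (G : Graph n) where
  open Boundary G

  -- x_(v,u) ⊕ y_(v,u): invariant under the constraints x_(v,u) ⊕ y_(v,u) = 0
  defect : VarSet n → Fin n → Fin n → Bool
  defect S v u = S xk v u xor S yk v u

  Symmetric : (Fin n → Fin n → Bool) → Set
  Symmetric C = ∀ u v → C u v ≡ C v u

  -- S is accounted for by the vertex set B (parity constraints used an odd
  -- number of times) and the symmetric edge set C (edge constraints used an
  -- odd number of times): along every edge the defect of S is C ⊕ B.
  Accounts : VarSet n → VSet n → (Fin n → Fin n → Bool) → Set
  Accounts S B C = ∀ v u → T (adj G v u) → defect S v u ≡ C v u xor B v

  weight : VarSet n → Fin n → Fin n → ℕ
  weight S v u = b2n (S xk v u) + b2n (S yk v u)

  defect-weight : ∀ S v u → T (defect S v u) → 1 ≤ weight S v u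
  defect-weight S v u with S xk v u | S yk v u
  ... | true  | _    = λ _ → s≤s z≤n
  ... | false | true = λ _ → s≤s z≤n

  gate : Bool → ℕ → ℕ
  gate b m = if b then m else 0

  -- An edge (a,b) leaving B is witnessed by a variable of S at (a,b) or (b,a):
  -- otherwise both defects vanish, forcing C a b ⊕ 1 = 0 = C b a = C a b.
  leaving-witnessed : ∀ {S B C} → Accounts S B C → Symmetric C → ∀ a b →
    b2n (leaves B a b)
      ≤ gate (B a ∧ not (B b)) (weight S a b) + gate (B a ∧ not (B b)) (weight S b a)
  leaving-witnessed {S} {B} {C} acc C-sym a b with adj G a b in ab | B a in Ba | B b in Bb
  ... | false | _     | _     = z≤n
  ... | true  | false | _     = z≤n
  ... | true  | true  | true  = z≤n
  ... | true  | true  | false =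
    [ (λ d → ≤-trans (defect-weight S a b d) (m≤m+n (weight S a b) (weight S b a)))
    , (λ d → ≤-trans (defect-weight S b a d) (m≤n+m (weight S b a) (weight S a b)))
    ]′ (T-xor (true⇒T one-defect))
    where
    one-defect : defect S a b xor defect S b a ≡ true
    one-defect = begin
      defect S a b xor defect S b a
        ≡⟨ cong₂ _xor_ (acc a b (true⇒T ab)) (acc b a (true⇒T (trans (Graph.sym G b a) ab))) ⟩
      (C a b xor B a) xor (C b a xor B b)
        ≡⟨ cong₂ (λ x y → (C a b xor x) xor y) Ba
                 (trans (cong (_xor B b) (C-sym b a)) (cong (C a b xor_) Bb)) ⟩
      (C a b xor true) xor (C a b xor false)
        ≡⟨ xor-one (C a b) ⟩
      true ∎
      where
      open ≡-Reasoning
      xor-one : ∀ c → (c xor true) xor (c xor false) ≡ true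
      xor-one true  = refl
      xor-one false = refl

  size≡∑ : ∀ S → size S ≡ ∑ (λ v → ∑ (weight S v))
  size≡∑ S = sumFin² (weight S)

  gate-both : ∀ x y m → gate (x ∧ not y) m + gate (y ∧ not x) m ≤ m
  gate-both true  true  m = z≤n
  gate-both true  false m = ≤-reflexive (+-identityʳ m)
  gate-both false true  m = ≤-refl
  gate-both false false m = z≤n

  boundary≤size : ∀ {S B C} → Accounts S B C → Symmetric C → boundary B ≤ size S
  boundary≤size {S} {B} {C} acc C-sym = begin
    boundary B
      ≤⟨ ∑-mono (λ a → ∑-mono (leaving-witnessed {S} {B} {C} acc C-sym a)) ⟩
    ∑ (λ a → ∑ (λ b → out a b (weight S a b) + out a b (weight S b a)))
      ≡⟨ ∑²-+ (λ a b → out a b (weight S a b)) (λ a b → out a b (weight S b a)) ⟩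
    ∑ (λ a → ∑ (λ b → out a b (weight S a b))) + ∑ (λ a → ∑ (λ b → out a b (weight S b a)))
      ≡⟨ cong (∑ (λ a → ∑ (λ b → out a b (weight S a b))) +_)
              (ℕΣ.∑-comm (λ a b → out a b (weight S b a))) ⟩
    ∑ (λ a → ∑ (λ b → out a b (weight S a b))) + ∑ (λ a → ∑ (λ b → out b a (weight S a b)))
      ≡⟨ ∑²-+ (λ a b → out a b (weight S a b)) (λ a b → out b a (weight S a b)) ⟨
    ∑ (λ a → ∑ (λ b → out a b (weight S a b) + out b a (weight S a b)))
      ≤⟨ ∑-mono (λ a → ∑-mono (λ b → gate-both (B a) (B b) (weight S a b))) ⟩
    ∑ (λ a → ∑ (weight S a))
      ≡⟨ size≡∑ S ⟨
    size S ∎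
    where
    open ≤-Reasoning
    out : Fin n → Fin n → ℕ → ℕ
    out a b = gate (B a ∧ not (B b))

  defect-step : ∀ {φ : Constraint G} {S S′} → Step φ S S′ → ∀ v u →
    defect S′ v u ≡ defect S v u xor defect (vars φ) v u
  defect-step {φ} {S} st v u = trans (cong₂ _xor_ (st xk v u) (st yk v u))
    (interchange (S xk v u) (vars φ xk v u) (S yk v u) (vars φ yk v u))

  edgeSet : Fin n → Fin n → Fin n → Fin n → Bool
  edgeSet u v x y = (⌊ u ≟ x ⌋ ∧ ⌊ v ≟ y ⌋) xor (⌊ v ≟ x ⌋ ∧ ⌊ u ≟ y ⌋)

  edgeSet-symmetric : ∀ u v → Symmetric (edgeSet u v)
  edgeSet-symmetric u v x y = trans (xor-comm (⌊ u ≟ x ⌋ ∧ ⌊ v ≟ y ⌋) (⌊ v ≟ x ⌋ ∧ ⌊ u ≟ y ⌋))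
    (cong₂ _xor_ (∧-comm ⌊ v ≟ x ⌋ ⌊ u ≟ y ⌋) (∧-comm ⌊ u ≟ x ⌋ ⌊ v ≟ y ⌋))

  accounts-xy : ∀ {v u} {p : T (adj G v u)} {S S′ B C} → Step {G = G} (xy v u p) S S′ →
    Accounts S B C → Accounts S′ B C
  accounts-xy {v} {u} {p} {S} {S′} st acc x y xy-edge = begin
    defect S′ x y                          ≡⟨ defect-step {xy v u p} {S} {S′} st x y ⟩
    defect S x y xor ((d xor false) xor d)  ≡⟨ cong (defect S x y xor_) (cancel d) ⟩
    defect S x y xor false                 ≡⟨ xor-identityʳ _ ⟩
    defect S x y                           ≡⟨ acc x y xy-edge ⟩
    _ ∎
    where
    open ≡-Reasoning
    d = ⌊ v ≟ x ⌋ ∧ ⌊ u ≟ y ⌋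
    cancel : ∀ b → (b xor false) xor b ≡ false
    cancel true  = refl
    cancel false = refl

  accounts-ysum : ∀ {v S S′ B C} → Step {G = G} (ysum v) S S′ →
    Accounts S B C → Accounts S′ (toggle B v) C
  accounts-ysum {v} {S} {S′} {B} {C} st acc x y xy-edge = begin
    defect S′ x y                                  ≡⟨ defect-step {ysum v} {S} {S′} st x y ⟩
    defect S x y xor (⌊ v ≟ x ⌋ ∧ adj G v y)        ≡⟨ cong₂ _xor_ (acc x y xy-edge) centre ⟩
    (C x y xor B x) xor ⌊ v ≟ x ⌋                  ≡⟨ xor-assoc (C x y) (B x) ⌊ v ≟ x ⌋ ⟩
    C x y xor toggle B v x ∎
    where
    open ≡-Reasoning
    centre : ⌊ v ≟ x ⌋ ∧ adj G v y ≡ ⌊ v ≟ x ⌋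
    centre with v ≟ x
    ... | yes refl = T⇒true xy-edge
    ... | no  _    = refl

  accounts-edge : ∀ {u v} {p : T (adj G u v)} {S S′ B C} → Step {G = G} (edge u v p) S S′ →
    Accounts S B C → Accounts S′ B (λ x y → C x y xor edgeSet u v x y)
  accounts-edge {u} {v} {p} {S} {S′} {B} {C} st acc x y xy-edge = begin
    defect S′ x y
      ≡⟨ defect-step {edge u v p} {S} {S′} st x y ⟩
    defect S x y xor (edgeSet u v x y xor false)
      ≡⟨ cong₂ _xor_ (acc x y xy-edge) (xor-identityʳ _) ⟩
    (C x y xor B x) xor edgeSet u v x y
      ≡⟨ xy∙z≈xz∙y (C x y) (B x) (edgeSet u v x y) ⟩
    (C x y xor edgeSet u v x y) xor B x ∎
    where open ≡-Reasoning

  accounts-∅ : ∀ {S B C} → (∀ k v u → S k v u ≡ false) → Accounts S B C →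
    ∀ v u → T (adj G v u) → C v u ≡ B v
  accounts-∅ {S} {B} {C} S≡∅ acc v u vu-edge =
    xor-zero (C v u) (B v) (trans (sym (acc v u vu-edge)) (cong₂ _xor_ (S≡∅ xk v u) (S≡∅ yk v u)))
    where
    xor-zero : ∀ c b → c xor b ≡ false → c ≡ b
    xor-zero true  true  _ = refl
    xor-zero false false _ = refl

module Parity {n : ℕ} (G : Graph n) (f g : EdgeFun n) where
  open Accounting G using (Symmetric; edgeSet)

  -- right-hand side of the edge constraint of {u,v}, counted at u < v only
  charge : Fin n → Fin n → Bool
  charge u v = adj G u v ∧ (f u v xor g u v) ∧ ⌊ toℕ u <? toℕ v ⌋

  parity : (Fin n → Fin n → Bool) → Bool
  parity C = ⊕Σ.sum (λ x → ⊕Σ.sum (λ y → C x y ∧ charge x y))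

  parity-xor : ∀ C D → parity (λ x y → C x y xor D x y) ≡ parity C xor parity D
  parity-xor C D = trans
    (⊕Σ.sum-cong-≗ λ x → trans
      (⊕Σ.sum-cong-≗ λ y → ∧-distribʳ-xor (charge x y) (C x y) (D x y))
      (⊕Σ.∑-distrib-+ (λ y → C x y ∧ charge x y) (λ y → D x y ∧ charge x y)))
    (⊕Σ.∑-distrib-+ (λ x → ⊕Σ.sum (λ y → C x y ∧ charge x y))
                    (λ x → ⊕Σ.sum (λ y → D x y ∧ charge x y)))

  parity-point : ∀ u v → parity (λ x y → ⌊ u ≟ x ⌋ ∧ ⌊ v ≟ y ⌋) ≡ charge u v
  parity-point u v = trans
    (⊕Σ.sum-cong-≗ λ x → begin
      ⊕Σ.sum (λ y → (⌊ u ≟ x ⌋ ∧ ⌊ v ≟ y ⌋) ∧ charge x y)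
        ≡⟨ ⊕Σ.sum-cong-≗ (λ y → ∧-assoc ⌊ u ≟ x ⌋ ⌊ v ≟ y ⌋ (charge x y)) ⟩
      ⊕Σ.sum (λ y → ⌊ u ≟ x ⌋ ∧ (⌊ v ≟ y ⌋ ∧ charge x y))
        ≡⟨ ⊕Σ.*-distribˡ-sum ⌊ u ≟ x ⌋ (λ y → ⌊ v ≟ y ⌋ ∧ charge x y) ⟨
      ⌊ u ≟ x ⌋ ∧ ⊕Σ.sum (λ y → ⌊ v ≟ y ⌋ ∧ charge x y)
        ≡⟨ cong (⌊ u ≟ x ⌋ ∧_) (⊕-delta v (charge x)) ⟩
      ⌊ u ≟ x ⌋ ∧ charge x v ∎)
    (⊕-delta u (λ x → charge x v))
    where open ≡-Reasoning

  -- Each edge is charged exactly once, in the direction of increasing index.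
  parity-edge : Symmetric f → Symmetric g → ∀ {u v} → T (adj G u v) →
    parity (edgeSet u v) ≡ f u v xor g u v
  parity-edge f-sym g-sym {u} {v} uv-edge = begin
    parity (edgeSet u v)
      ≡⟨ parity-xor (λ x y → ⌊ u ≟ x ⌋ ∧ ⌊ v ≟ y ⌋) (λ x y → ⌊ v ≟ x ⌋ ∧ ⌊ u ≟ y ⌋) ⟩
    parity (λ x y → ⌊ u ≟ x ⌋ ∧ ⌊ v ≟ y ⌋) xor parity (λ x y → ⌊ v ≟ x ⌋ ∧ ⌊ u ≟ y ⌋)
      ≡⟨ cong₂ _xor_ (parity-point u v) (parity-point v u) ⟩
    charge u v xor charge v u
      ≡⟨ cong₂ _xor_ (cong (λ a → a ∧ h ∧ ⌊ toℕ u <? toℕ v ⌋) (T⇒true uv-edge))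
                     (cong₂ (λ a b → a ∧ b ∧ ⌊ toℕ v <? toℕ u ⌋)
                            (trans (Graph.sym G v u) (T⇒true uv-edge))
                            (cong₂ _xor_ (f-sym v u) (g-sym v u))) ⟩
    (h ∧ ⌊ toℕ u <? toℕ v ⌋) xor (h ∧ ⌊ toℕ v <? toℕ u ⌋)
      ≡⟨ ∧-distribˡ-xor h _ _ ⟨
    h ∧ (⌊ toℕ u <? toℕ v ⌋ xor ⌊ toℕ v <? toℕ u ⌋)
      ≡⟨ cong (h ∧_) exactly-one ⟩
    h ∧ true
      ≡⟨ ∧-identityʳ h ⟩
    h ∎
    where
    open ≡-Reasoning
    h = f u v xor g u v
    exactly-one : ⌊ toℕ u <? toℕ v ⌋ xor ⌊ toℕ v <? toℕ u ⌋ ≡ true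
    exactly-one with <-cmp (toℕ u) (toℕ v)
    ... | tri< u<v _ v≮u = cong₂ _xor_ (⌊⌋-yes (toℕ u <? toℕ v) u<v) (⌊⌋-no (toℕ v <? toℕ u) v≮u)
    ... | tri> u≮v _ v<u = cong₂ _xor_ (⌊⌋-no (toℕ u <? toℕ v) u≮v) (⌊⌋-yes (toℕ v <? toℕ u) v<u)
    ... | tri≈ _ u≡v _ with toℕ-injective u≡v
    ...   | refl = ⊥-elim (subst T (Graph.irrefl G u) uv-edge)

  parity-add-edge : Symmetric f → Symmetric g → ∀ C {u v} → T (adj G u v) →
    parity (λ x y → C x y xor edgeSet u v x y) ≡ parity C xor (f u v xor g u v)
  parity-add-edge f-sym g-sym C {u} {v} uv-edge =
    trans (parity-xor C (edgeSet u v)) (cong (parity C xor_) (parity-edge f-sym g-sym uv-edge))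

  parity-zero : ∀ C → (∀ x y → T (adj G x y) → C x y ≡ false) → parity C ≡ false
  parity-zero C C-off = trans
    (⊕Σ.sum-cong-≗ λ x → trans (⊕Σ.sum-cong-≗ λ y → term x y) (⊕Σ.sum-replicate-zero n))
    (⊕Σ.sum-replicate-zero n)
    where
    term : ∀ x y → C x y ∧ charge x y ≡ false
    term x y with T? (adj G x y)
    ... | yes xy-edge = cong (_∧ charge x y) (C-off x y xy-edge)
    ... | no  ¬edge   = trans (cong (λ a → C x y ∧ a ∧ _) (¬T⇒false ¬edge)) (∧-zeroʳ (C x y))

module Refutation {n : ℕ} (G : Graph n) (f g : EdgeFun n) (r : ℕ)
  (f-sym : ∀ u v → f u v ≡ f v u) (g-sym : ∀ u v → g u v ≡ g v u)
  (connected : Connected G) where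
  open Boundary G
  open Growth G r
  open Accounting G
  open Parity G f g

  NarrowOrdering : Set
  NarrowOrdering = Σ[ π ∈ Permutation′ n ] orderWidth G π ≤ r

  head-size : ∀ {S T b} → Deriv G f g r S T b → size S ≤ r
  head-size (done s _)     = s
  head-size (step _ s _ _) = s

  -- When S = ∅, B is empty or everything (it is constant, by connectivity).
  -- If B is everything its frontier is a grown set containing all vertices;
  -- if B is empty then so is C along every edge, and C has parity 0.
  terminal : ∀ {S B C} → (∀ k v u → S k v u ≡ false) → Accounts S B C → Symmetric C →
    Frontier B → NarrowOrdering ⊎ false ≡ parity C
  terminal {S} {B} {C} S≡∅ acc C-sym F with any? (λ v → T? (B v))
  ... | yes (v₀ , v₀∈B) =
    inj₁ (grown-everything grown (λ a → covers a (subst T (B-constant v₀ a) v₀∈B)))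
    where
    open Frontier F
    C≡B : ∀ v u → T (adj G v u) → C v u ≡ B v
    C≡B = accounts-∅ {S} {B} {C} S≡∅ acc
    B-constant : ∀ u v → B u ≡ B v
    B-constant = connected-constant connected B λ v u vu-edge →
      trans (sym (C≡B v u vu-edge))
            (trans (C-sym v u) (C≡B u v (subst T (Graph.sym G v u) vu-edge)))
  ... | no B-empty = inj₂ (sym (parity-zero C λ x y xy-edge →
    trans (accounts-∅ {S} {B} {C} S≡∅ acc x y xy-edge) (¬T⇒false (λ x∈B → B-empty (x , x∈B)))))

  follow : ∀ {S b} → Deriv G f g r S ∅ b → ∀ {B C} → Accounts S B C → Symmetric C →
    Frontier B → NarrowOrdering ⊎ b ≡ parity C
  follow (done _ S≡∅) acc C-sym F = terminal S≡∅ acc C-sym F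
  follow {S} (step {S′ = S′} (xy v u p) _ st rest) {B} {C} acc C-sym F =
    follow rest (accounts-xy {v} {u} {p} {S} {S′} {B} {C} st acc) C-sym F
  follow {S} (step {S′ = S′} (ysum v) _ st rest) {B} {C} acc C-sym F =
    follow rest acc′ C-sym (frontier-toggle v B′-small F)
    where
    acc′ : Accounts S′ (toggle B v) C
    acc′ = accounts-ysum {v} {S} {S′} {B} {C} st acc
    B′-small : boundary (toggle B v) ≤ r
    B′-small = ≤-trans (boundary≤size {S′} acc′ C-sym) (head-size rest)
  follow {S} (step {S′ = S′} (edge u v uv-edge) _ st rest) {B} {C} acc C-sym F
    with follow rest (accounts-edge {u} {v} {uv-edge} {S} {S′} {B} {C} st acc)
                (λ x y → cong₂ _xor_ (C-sym x y) (edgeSet-symmetric u v x y)) F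
  ... | inj₁ narrow = inj₁ narrow
  ... | inj₂ b≡parity = inj₂ (begin
    h xor _
      ≡⟨ cong (h xor_) b≡parity ⟩
    h xor parity (λ x y → C x y xor edgeSet u v x y)
      ≡⟨ cong (h xor_) (parity-add-edge f-sym g-sym C uv-edge) ⟩
    h xor (parity C xor h)
      ≡⟨ xor-cancel h (parity C) ⟩
    parity C ∎)
    where
    open ≡-Reasoning
    h = f u v xor g u v

proposition1 : ∀ {n} (G : Graph n) (r : ℕ) (f g : EdgeFun n) →
    Connected G → Cubic G → HasCutwidth G (suc r) →
    (∀ u v → f u v ≡ f v u) → (∀ u v → g u v ≡ g v u) →
    ¬ (∅ ∼⁻[ G , f , g , r ] ∅)
proposition1 G r f g connected _ (_ , wide) f-sym g-sym refutation
  with Refutation.follow G f g r f-sym g-sym connected refutation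
         {B = ∅ᵛ} {C = λ _ _ → false} (λ _ _ _ → refl) (λ _ _ → refl) (Growth.frontier-∅ G r)
... | inj₁ (π , narrow)  = ≤⇒≯ narrow (wide π)
... | inj₂ odd≡parity = case trans odd≡parity (Parity.parity-zero G f g _ (λ _ _ _ → refl)) of λ ()
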